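{- For $n\ge 2$, the Kirchhoff index of the enhanced hypercube $Q_{n,n-1}$ is \[Kf(Q_{n,n-1})=2^{n-1}\left(\sum_{t=1}^{n-2}\frac{2^{t}-1}{t}+3\,\frac{(n-2)2^{n-1}+1}{n(n-1)}\right).\]
   Context: For $n\ge 2$ and $1\le k\le n-1$, the enhanced hypercube $Q_{n,k}$ is the simple graph whose vertices are the binary strings $x_1x_2\cdots x_n$ ($x_i\in\{0,1\}$), where $X=x_1\cdots x_n$ and $Y$ are adjacent iff either $Y$ is obtained from $X$ by complementing exactly one coordinate ($1\le i\le n$), or $Y=x_1\cdots x_{k-1}\overline{x_k}\,\overline{x_{k+1}}\cdots\overline{x_n}$; here $k=n-1$. For a connected graph $\Gamma$, the resistance distance $r_{ij}$ is the effective resistance between $v_i,v_j$ when every edge is a unit resistor, and $Kf(\Gamma)=\sum_{i<j} r_{ij}$. An empty sum is $0$. -}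

module Defs where

open import Data.Bool using (Bool; true; false; not; if_then_else_; _∨_)
open import Data.Nat as ℕ using (ℕ; zero; suc; _≤ᵇ_; _^_; _∸_)
open import Data.Fin using (Fin; toℕ)
open import Data.Vec using (Vec; []; _∷_; lookup; tabulate)
import Data.Vec.Properties as VecP
open import Data.List using (List; []; _∷_; map; _++_; foldr)
open import Data.Product using (_×_; _,_; Σ)
open import Data.Integer using (+_)
open import Data.Rational using (ℚ; 0ℚ; 1ℚ; _+_; _-_; _*_; _/_)
import Data.Bool.Properties as BoolP
open import Relation.Nullary.Decidable using (⌊_⌋)

Vertex : ℕ → Set
Vertex n = Vec Bool n

allVertices : (n : ℕ) → List (Vertex n)
allVertices zero = [] ∷ []
allVertices (suc n) = map (false ∷_) (allVertices n) ++ map (true ∷_) (allVertices n)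

_==ᵛ_ : ∀ {n} → Vertex n → Vertex n → Bool
x ==ᵛ y = ⌊ VecP.≡-dec BoolP._≟_ x y ⌋

hamming : ∀ {n} → Vertex n → Vertex n → ℕ
hamming [] [] = 0
hamming (a ∷ x) (b ∷ y) = (if ⌊ a BoolP.≟ b ⌋ then 0 else 1) ℕ.+ hamming x y

-- complement the coordinates x_k, x_{k+1}, ..., x_n (1-based positions)
complementFrom : ∀ {n} → ℕ → Vertex n → Vertex n
complementFrom k x = tabulate λ i → if k ≤ᵇ suc (toℕ i) then not (lookup x i) else lookup x i

adjQ : (n k : ℕ) → Vertex n → Vertex n → Bool
adjQ n k x y = ⌊ hamming x y ℕ.≟ 1 ⌋ ∨ (y ==ᵛ complementFrom k x)

sumℚ : List ℚ → ℚ
sumℚ = foldr _+_ 0ℚ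

laplacian : (n k : ℕ) → (Vertex n → ℚ) → Vertex n → ℚ
laplacian n k f v = sumℚ (map (λ u → if adjQ n k v u then f v - f u else 0ℚ) (allVertices n))

indicator : ∀ {n} → Vertex n → Vertex n → ℚ
indicator a v = if v ==ᵛ a then 1ℚ else 0ℚ

-- φ a b is a node potential for a unit current entering at a and leaving at b
-- (Kirchhoff/Ohm laws with unit resistors): L φ = e_a - e_b.
IsPotentialFamily : (n k : ℕ) → (Vertex n → Vertex n → Vertex n → ℚ) → Set
IsPotentialFamily n k φ = ∀ a b v → laplacian n k (φ a b) v ≡ indicator a v - indicator b v
  where open import Relation.Binary.PropositionalEquality using (_≡_)

resistance : ∀ {n} → (Vertex n → Vertex n → Vertex n → ℚ) → Vertex n → Vertex n → ℚ
resistance φ a b = φ a b a - φ a b b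

pairs : ∀ {A : Set} → List A → List (A × A)
pairs [] = []
pairs (x ∷ xs) = map (x ,_) xs ++ pairs xs

kirchhoffIndex : (n : ℕ) → (Vertex n → Vertex n → Vertex n → ℚ) → ℚ
kirchhoffIndex n φ = sumℚ (map (λ p → resistance φ (Data.Product.proj₁ p) (Data.Product.proj₂ p)) (pairs (allVertices n)))

sumTerms : ℕ → ℚ
sumTerms zero = 0ℚ
sumTerms (suc s) = sumTerms s + (+ (2 ^ suc s ∸ 1)) / suc s

formula : ℕ → ℚ
formula zero = 0ℚ
formula (suc zero) = 0ℚ
formula (suc (suc m)) =
  (+ (2 ^ suc m) / 1) *
    (sumTerms m + (+ 3 / 1) * ((+ (m ℕ.* 2 ^ suc m ℕ.+ 1)) / (suc (suc m) ℕ.* suc m)))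

module Submission where

-- Q_{n,k} is the Cayley graph of the group (ℤ₂)ⁿ under bitwise xor ⊕, with
-- connection set the unit vectors together with the vector complementing the
-- coordinates k,…,n.  Its Laplacian L is therefore diagonalised by the
-- characters χ_S(v) = (-1)^{S·v}, with eigenvalues Λ(S).  If Λ(S) ≠ 0 for
-- every S ≠ 0 (a spectral form of connectedness), the Green function
-- G = 2⁻ⁿ Σ_S Λ(S)⁻¹ χ_S solves L G = δ₀ - 2⁻ⁿ, so ψ_ab(v) = G(v⊕a) - G(v⊕b)
-- is a potential for a unit current from a to b.  Self-adjointness of L makes
-- the resistances r_ab = 2(G(0) - G(a⊕b)) independent of the chosen
-- potentials, and summing over pairs gives Kf = 2ⁿ Σ_S Λ(S)⁻¹ (with 0⁻¹ = 0).  For n = m+2, k = n-1 the eigenvalue is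
-- 2·|S₁…S_m| plus 4 or 0 according as the last two bits of S are not both
-- zero, so the spectral sum is the binomial sum Σᵢ C(m,i)(1/(2i) + 3/(2i+4)),
-- which is evaluated in closed form to give the stated formula.

open import Defs
open import Data.Nat using (ℕ; _≤_; _∸_)
open import Data.Product using (Σ; _×_)
open import Data.Rational using (ℚ)
open import Relation.Binary.PropositionalEquality using (_≡_)

open import Data.Nat as ℕ using (zero; suc; s≤s)
import Data.Nat.Properties as ℕP
open import Data.Bool using (Bool; true; false; not; if_then_else_; _∨_; _∧_; _xor_; T)
open import Data.Unit using (tt)
import Data.Bool.Properties as BoolP
open import Data.Integer as ℤ using (+_)
import Data.Integer.Properties as ℤP
import Data.Integer.Solver as ℤSolver
open import Data.Rational using (0ℚ; 1ℚ; _+_; _*_; _-_; -_; _/_; 1/_; toℚᵘ; ≢-nonZero)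
import Data.Rational.Properties as QP
import Data.Rational.Unnormalised as U
import Data.Rational.Unnormalised.Properties as UP
open import Data.Rational.Solver using (module +-*-Solver)
open +-*-Solver using (solve; _:+_; _:*_; _:-_; :-_; _:=_; con)
open import Data.Fin using (Fin)
import Data.Fin as F
open import Data.Vec using (Vec; []; _∷_; lookup; tabulate; replicate; zipWith)
import Data.Vec.Properties as VecP
open import Data.List using (List; []; _∷_; map; _++_)
open import Data.Product using (_,_; proj₁; proj₂)
open import Relation.Binary.PropositionalEquality using (refl; sym; trans; cong; cong₂; subst; module ≡-Reasoning)
open import Relation.Nullary using (Dec; yes; no; ¬_)
open import Relation.Nullary.Decidable using (⌊_⌋)
open import Data.Empty using (⊥-elim)
open import Function using (_∘_)

ι : ℕ → ℚ
ι a = + a / 1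

toℚᵘ-/ : ∀ a b → toℚᵘ (+ a / suc b) U.≃ U.mkℚᵘ (+ a) b
toℚᵘ-/ a b = QP.toℚᵘ-fromℚᵘ (U.mkℚᵘ (+ a) b)

ι-suc : ∀ k → ι (suc k) ≡ 1ℚ + ι k
ι-suc k = QP.toℚᵘ-injective (UP.≃-trans (toℚᵘ-/ (suc k) 0) (UP.≃-trans (U.*≡* cross)
  (UP.≃-sym (UP.≃-trans (QP.toℚᵘ-homo-+ 1ℚ (ι k))
    (UP.+-cong {toℚᵘ 1ℚ} {U.mkℚᵘ (+ 1) 0} UP.≃-refl (toℚᵘ-/ k 0))))))
  where
  open ℤSolver.+-*-Solver using () renaming (solve to solveℤ; _:+_ to _⊞_; _:*_ to _⊠_; _:=_ to _⊜_; con to cℤ)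
  cross : + suc k ℤ.* + 1 ≡ (+ 1 ℤ.* + 1 ℤ.+ + k ℤ.* + 1) ℤ.* + 1
  cross = solveℤ 1 (λ x → (cℤ (+ 1) ⊞ x) ⊠ cℤ (+ 1) ⊜ (cℤ (+ 1) ⊠ cℤ (+ 1) ⊞ x ⊠ cℤ (+ 1)) ⊠ cℤ (+ 1)) refl (+ k)

/-*-denominator : ∀ a b → (+ a / suc b) * ι (suc b) ≡ ι a
/-*-denominator a b = QP.toℚᵘ-injective (UP.≃-trans (QP.toℚᵘ-homo-* (+ a / suc b) (ι (suc b)))
  (UP.≃-trans (UP.*-cong {toℚᵘ (+ a / suc b)} {U.mkℚᵘ (+ a) b} (toℚᵘ-/ a b) (toℚᵘ-/ (suc b) 0))
  (UP.≃-trans (U.*≡* cross) (UP.≃-sym (toℚᵘ-/ a 0)))))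
  where
  open ℤSolver.+-*-Solver using () renaming (solve to solveℤ; _:*_ to _⊠_; _:=_ to _⊜_; con to cℤ)
  cross : (+ a ℤ.* + suc b) ℤ.* + 1 ≡ + a ℤ.* + (suc b ℕ.* 1)
  cross = trans (solveℤ 2 (λ x y → (x ⊠ y) ⊠ cℤ (+ 1) ⊜ x ⊠ (y ⊠ cℤ (+ 1))) refl (+ a) (+ suc b))
                (cong (+ a ℤ.*_) (sym (ℤP.pos-* (suc b) 1)))

ι-+ : ∀ a b → ι (a ℕ.+ b) ≡ ι a + ι b
ι-+ zero b = sym (QP.+-identityˡ (ι b))
ι-+ (suc a) b = begin
  ι (suc (a ℕ.+ b))  ≡⟨ ι-suc (a ℕ.+ b) ⟩
  1ℚ + ι (a ℕ.+ b)   ≡⟨ cong (λ t → 1ℚ + t) (ι-+ a b) ⟩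
  1ℚ + (ι a + ι b)   ≡⟨ sym (QP.+-assoc 1ℚ (ι a) (ι b)) ⟩
  (1ℚ + ι a) + ι b   ≡⟨ cong (_+ ι b) (sym (ι-suc a)) ⟩
  ι (suc a) + ι b    ∎
  where open ≡-Reasoning

ι-* : ∀ a b → ι (a ℕ.* b) ≡ ι a * ι b
ι-* zero b = sym (QP.*-zeroˡ (ι b))
ι-* (suc a) b = begin
  ι (b ℕ.+ a ℕ.* b)    ≡⟨ ι-+ b (a ℕ.* b) ⟩
  ι b + ι (a ℕ.* b)    ≡⟨ cong (λ t → ι b + t) (ι-* a b) ⟩
  ι b + ι a * ι b      ≡⟨ solve 2 (λ x y → y :+ x :* y := (con 1ℚ :+ x) :* y) refl (ι a) (ι b) ⟩
  (1ℚ + ι a) * ι b     ≡⟨ cong (_* ι b) (sym (ι-suc a)) ⟩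
  ι (suc a) * ι b      ∎
  where open ≡-Reasoning

ι-∸1 : ∀ x → 1 ℕ.≤ x → ι (x ∸ 1) ≡ ι x - 1ℚ
ι-∸1 x 1≤x = begin
  ι (x ∸ 1)                ≡⟨ solve 1 (λ a → a := (a :+ con (ι 1)) :- con 1ℚ) refl (ι (x ∸ 1)) ⟩
  (ι (x ∸ 1) + ι 1) - 1ℚ   ≡⟨ cong (_- 1ℚ) (sym (ι-+ (x ∸ 1) 1)) ⟩
  ι (x ∸ 1 ℕ.+ 1) - 1ℚ     ≡⟨ cong (λ t → ι t - 1ℚ) (ℕP.m∸n+n≡m 1≤x) ⟩
  ι x - 1ℚ                 ∎
  where open ≡-Reasoning

ι-suc≢0 : ∀ b → ¬ (ι (suc b) ≡ 0ℚ)
ι-suc≢0 b eq = QP.1≢0 (begin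
  1ℚ                       ≡⟨ sym (/-*-denominator 1 b) ⟩
  (+ 1 / suc b) * ι (suc b) ≡⟨ cong ((+ 1 / suc b) *_) eq ⟩
  (+ 1 / suc b) * 0ℚ        ≡⟨ QP.*-zeroʳ (+ 1 / suc b) ⟩
  0ℚ                        ∎)
  where open ≡-Reasoning

ι≢0 : ∀ k → .{{_ : ℕ.NonZero k}} → ¬ (ι k ≡ 0ℚ)
ι≢0 (suc k) = ι-suc≢0 k

-- The total inverse on ℚ, with 0⁻¹ = 0; it lets the spectral sums below run
-- over all characters, the trivial one contributing nothing.
inv : ℚ → ℚ
inv q with q QP.≟ 0ℚ
... | yes _ = 0ℚ
... | no q≢0 = (1/ q) {{≢-nonZero q≢0}}

*-inv : ∀ q → ¬ (q ≡ 0ℚ) → q * inv q ≡ 1ℚ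
*-inv q q≢0 with q QP.≟ 0ℚ
... | yes q≡0 = ⊥-elim (q≢0 q≡0)
... | no q≢0′ = QP.*-inverseʳ q {{≢-nonZero q≢0′}}

divide : ∀ x c y → ¬ (c ≡ 0ℚ) → x * c ≡ y → x ≡ y * inv c
divide x c y c≢0 xc≡y = begin
  x                  ≡⟨ sym (QP.*-identityʳ x) ⟩
  x * 1ℚ             ≡⟨ cong (x *_) (sym (*-inv c c≢0)) ⟩
  x * (c * inv c)    ≡⟨ sym (QP.*-assoc x c (inv c)) ⟩
  (x * c) * inv c    ≡⟨ cong (_* inv c) xc≡y ⟩
  y * inv c          ∎
  where open ≡-Reasoning

*-cancelˡ : ∀ c x y → ¬ (c ≡ 0ℚ) → c * x ≡ c * y → x ≡ y
*-cancelˡ c x y c≢0 cx≡cy = trans (divide x c (x * c) c≢0 refl)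
  (trans (cong (_* inv c) (trans (QP.*-comm x c) (trans cx≡cy (QP.*-comm c y))))
         (sym (divide y c (y * c) c≢0 refl)))

inv-unique : ∀ a b → a * b ≡ 1ℚ → b ≡ inv a
inv-unique a b ab≡1 = begin
  b                    ≡⟨ sym (QP.*-identityʳ b) ⟩
  b * 1ℚ               ≡⟨ cong (b *_) (sym (*-inv a a≢0)) ⟩
  b * (a * inv a)      ≡⟨ solve 3 (λ a b c → b :* (a :* c) := (a :* b) :* c) refl a b (inv a) ⟩
  (a * b) * inv a      ≡⟨ cong (_* inv a) ab≡1 ⟩
  1ℚ * inv a           ≡⟨ QP.*-identityˡ (inv a) ⟩
  inv a                ∎
  where
  open ≡-Reasoning
  a≢0 : ¬ (a ≡ 0ℚ)
  a≢0 a≡0 = QP.1≢0 (trans (sym ab≡1) (trans (cong (_* b) a≡0) (QP.*-zeroˡ b)))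

inv-ι2* : ∀ x → inv (ι 2 * x) ≡ inv (ι 2) * inv x
inv-ι2* x = byCases (x QP.≟ 0ℚ)
  where
  open ≡-Reasoning
  byCases : Dec (x ≡ 0ℚ) → inv (ι 2 * x) ≡ inv (ι 2) * inv x
  byCases (yes refl) = sym (QP.*-zeroʳ (inv (ι 2)))
  byCases (no x≢0) = sym (inv-unique (ι 2 * x) (inv (ι 2) * inv x) (begin
    (ι 2 * x) * (inv (ι 2) * inv x)
      ≡⟨ solve 4 (λ a b c d → (a :* b) :* (c :* d) := (a :* c) :* (b :* d)) refl (ι 2) x (inv (ι 2)) (inv x) ⟩
    (ι 2 * inv (ι 2)) * (x * inv x)  ≡⟨ cong₂ _*_ (*-inv (ι 2) (ι-suc≢0 1)) (*-inv x x≢0) ⟩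
    1ℚ * 1ℚ                          ≡⟨ QP.*-identityˡ 1ℚ ⟩
    1ℚ                               ∎))

inv-ι* : ∀ k → inv (ι k) * ι k ≡ (if k ℕ.≡ᵇ 0 then 0ℚ else 1ℚ)
inv-ι* zero = refl
inv-ι* (suc k) = trans (QP.*-comm (inv (ι (suc k))) (ι (suc k))) (*-inv (ι (suc k)) (ι-suc≢0 k))

/-as-inv : ∀ a b → (+ a / suc b) ≡ ι a * inv (ι (suc b))
/-as-inv a b = divide _ _ _ (ι-suc≢0 b) (/-*-denominator a b)

sumL : ∀ {A : Set} → List A → (A → ℚ) → ℚ
sumL xs f = sumℚ (map f xs)

sumL-cong : ∀ {A : Set} (xs : List A) {f g : A → ℚ} → (∀ x → f x ≡ g x) → sumL xs f ≡ sumL xs g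
sumL-cong [] f≗g = refl
sumL-cong (x ∷ xs) f≗g = cong₂ _+_ (f≗g x) (sumL-cong xs f≗g)

sumL-++ : ∀ {A : Set} (xs ys : List A) (f : A → ℚ) → sumL (xs ++ ys) f ≡ sumL xs f + sumL ys f
sumL-++ [] ys f = sym (QP.+-identityˡ _)
sumL-++ (x ∷ xs) ys f = trans (cong (λ t → f x + t) (sumL-++ xs ys f)) (sym (QP.+-assoc (f x) _ _))

sumL-map : ∀ {A B : Set} (xs : List A) (g : A → B) (f : B → ℚ) → sumL (map g xs) f ≡ sumL xs (f ∘ g)
sumL-map [] g f = refl
sumL-map (x ∷ xs) g f = cong (λ t → f (g x) + t) (sumL-map xs g f)

sumL-+ : ∀ {A : Set} (xs : List A) (f g : A → ℚ) → sumL xs (λ x → f x + g x) ≡ sumL xs f + sumL xs g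
sumL-+ [] f g = refl
sumL-+ (x ∷ xs) f g = trans (cong (λ t → (f x + g x) + t) (sumL-+ xs f g))
  (solve 4 (λ a b c d → (a :+ b) :+ (c :+ d) := (a :+ c) :+ (b :+ d)) refl (f x) (g x) (sumL xs f) (sumL xs g))

sumL-- : ∀ {A : Set} (xs : List A) (f g : A → ℚ) → sumL xs (λ x → f x - g x) ≡ sumL xs f - sumL xs g
sumL-- [] f g = refl
sumL-- (x ∷ xs) f g = trans (cong (λ t → (f x - g x) + t) (sumL-- xs f g))
  (solve 4 (λ a b c d → (a :- b) :+ (c :- d) := (a :+ c) :- (b :+ d)) refl (f x) (g x) (sumL xs f) (sumL xs g))

sumL-*ˡ : ∀ {A : Set} (xs : List A) (c : ℚ) (f : A → ℚ) → sumL xs (λ x → c * f x) ≡ c * sumL xs f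
sumL-*ˡ [] c f = sym (QP.*-zeroʳ c)
sumL-*ˡ (x ∷ xs) c f = trans (cong (λ t → c * f x + t) (sumL-*ˡ xs c f)) (sym (proj₁ QP.*-distrib-+ c (f x) _))

sumL-*ʳ : ∀ {A : Set} (xs : List A) (c : ℚ) (f : A → ℚ) → sumL xs (λ x → f x * c) ≡ sumL xs f * c
sumL-*ʳ xs c f = trans (sumL-cong xs (λ x → QP.*-comm (f x) c)) (trans (sumL-*ˡ xs c f) (QP.*-comm c _))

sumL-0 : ∀ {A : Set} (xs : List A) → sumL xs (λ _ → 0ℚ) ≡ 0ℚ
sumL-0 [] = refl
sumL-0 (x ∷ xs) = trans (QP.+-identityˡ _) (sumL-0 xs)

fubini : ∀ {A B : Set} (xs : List A) (ys : List B) (f : A → B → ℚ) →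
  sumL xs (λ x → sumL ys (f x)) ≡ sumL ys (λ y → sumL xs (λ x → f x y))
fubini [] ys f = sym (sumL-0 ys)
fubini (x ∷ xs) ys f = trans (cong (λ t → sumL ys (f x) + t) (fubini xs ys f))
  (sym (sumL-+ ys (f x) (λ y → sumL xs (λ x′ → f x′ y))))

pairs-sum : ∀ {A : Set} (xs : List A) (h : A → A → ℚ) → (∀ x y → h x y ≡ h y x) →
  ι 2 * sumL (pairs xs) (λ p → h (proj₁ p) (proj₂ p))
    ≡ sumL xs (λ x → sumL xs (h x)) - sumL xs (λ x → h x x)
pairs-sum [] h h-sym = refl
pairs-sum (x ∷ xs) h h-sym = begin
  ι 2 * sumL (map (x ,_) xs ++ pairs xs) H
    ≡⟨ cong (ι 2 *_) (sumL-++ (map (x ,_) xs) (pairs xs) H) ⟩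
  ι 2 * (sumL (map (x ,_) xs) H + sumL (pairs xs) H)
    ≡⟨ cong (λ t → ι 2 * (t + sumL (pairs xs) H)) (sumL-map xs (x ,_) H) ⟩
  ι 2 * (row + sumL (pairs xs) H)
    ≡⟨ proj₁ QP.*-distrib-+ (ι 2) row _ ⟩
  ι 2 * row + ι 2 * sumL (pairs xs) H
    ≡⟨ cong (λ t → ι 2 * row + t) (pairs-sum xs h h-sym) ⟩
  ι 2 * row + (rest - diag)
    ≡⟨ solve 4 (λ a r d e → con (ι 2) :* r :+ (d :- e) := (a :+ r :+ (r :+ d)) :- (a :+ e)) refl (h x x) row rest diag ⟩
  (h x x + row + (row + rest)) - (h x x + diag)
    ≡⟨ cong (λ t → (h x x + row + (t + rest)) - (h x x + diag)) (sumL-cong xs (h-sym x)) ⟩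
  (h x x + row + (column + rest)) - (h x x + diag)
    ≡⟨ cong (λ t → (h x x + row + t) - (h x x + diag)) (sym (sumL-+ xs (λ y → h y x) (λ y → sumL xs (h y)))) ⟩
  (h x x + row + sumL xs (λ y → h y x + sumL xs (h y))) - (h x x + diag) ∎
  where
  open ≡-Reasoning
  H : _ → ℚ
  H p = h (proj₁ p) (proj₂ p)
  row : ℚ
  row = sumL xs (h x)
  column : ℚ
  column = sumL xs (λ y → h y x)
  rest : ℚ
  rest = sumL xs (λ y → sumL xs (h y))
  diag : ℚ
  diag = sumL xs (λ y → h y y)

Σv : (n : ℕ) → (Vertex n → ℚ) → ℚ
Σv n = sumL (allVertices n)

Σv-cong : ∀ n {f g : Vertex n → ℚ} → (∀ x → f x ≡ g x) → Σv n f ≡ Σv n g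
Σv-cong n = sumL-cong (allVertices n)

Σv-suc : ∀ n (f : Vertex (suc n) → ℚ) → Σv (suc n) f ≡ Σv n (λ v → f (false ∷ v)) + Σv n (λ v → f (true ∷ v))
Σv-suc n f = trans (sumL-++ (map (false ∷_) (allVertices n)) _ f)
  (cong₂ _+_ (sumL-map (allVertices n) (false ∷_) f) (sumL-map (allVertices n) (true ∷_) f))

-- 2ⁿ as a rational, in the shape produced by Σv-suc.
pow2 : ℕ → ℚ
pow2 zero = 1ℚ
pow2 (suc n) = pow2 n + pow2 n

pow2-ι : ∀ n → pow2 n ≡ ι (2 ℕ.^ n)
pow2-ι zero = refl
pow2-ι (suc n) = trans (cong₂ _+_ (pow2-ι n) (pow2-ι n)) (trans (sym (ι-+ (2 ℕ.^ n) (2 ℕ.^ n)))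
  (cong (λ t → ι (2 ℕ.^ n ℕ.+ t)) (sym (ℕP.+-identityʳ (2 ℕ.^ n)))))

pow2≢0 : ∀ n → ¬ (pow2 n ≡ 0ℚ)
pow2≢0 n eq = ι≢0 (2 ℕ.^ n) {{ℕP.m^n≢0 2 n}} (trans (sym (pow2-ι n)) eq)

_⊕_ : ∀ {n} → Vertex n → Vertex n → Vertex n
_⊕_ = zipWith _xor_

z : ∀ n → Vertex n
z n = replicate n false

⊕-comm : ∀ {n} (x y : Vertex n) → x ⊕ y ≡ y ⊕ x
⊕-comm [] [] = refl
⊕-comm (a ∷ x) (b ∷ y) = cong₂ _∷_ (BoolP.xor-comm a b) (⊕-comm x y)

⊕-assoc : ∀ {n} (x y w : Vertex n) → (x ⊕ y) ⊕ w ≡ x ⊕ (y ⊕ w)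
⊕-assoc [] [] [] = refl
⊕-assoc (a ∷ x) (b ∷ y) (c ∷ w) = cong₂ _∷_ (BoolP.xor-assoc a b c) (⊕-assoc x y w)

⊕-self : ∀ {n} (x : Vertex n) → x ⊕ x ≡ z n
⊕-self [] = refl
⊕-self (a ∷ x) = cong₂ _∷_ (BoolP.xor-same a) (⊕-self x)

⊕-z : ∀ {n} (x : Vertex n) → x ⊕ z n ≡ x
⊕-z [] = refl
⊕-z (a ∷ x) = cong₂ _∷_ (BoolP.xor-identityʳ a) (⊕-z x)

z-⊕ : ∀ {n} (x : Vertex n) → z n ⊕ x ≡ x
z-⊕ [] = refl
z-⊕ (a ∷ x) = cong (a ∷_) (z-⊕ x)

⊕-cancel : ∀ {n} (x y : Vertex n) → (x ⊕ y) ⊕ y ≡ x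
⊕-cancel x y = trans (⊕-assoc x y y) (trans (cong (x ⊕_) (⊕-self y)) (⊕-z x))

⊕-translate : ∀ {n} (v d c : Vertex n) → (v ⊕ d) ⊕ (v ⊕ c) ≡ d ⊕ c
⊕-translate v d c = begin
  (v ⊕ d) ⊕ (v ⊕ c)   ≡⟨ cong (_⊕ (v ⊕ c)) (⊕-comm v d) ⟩
  (d ⊕ v) ⊕ (v ⊕ c)   ≡⟨ ⊕-assoc d v (v ⊕ c) ⟩
  d ⊕ (v ⊕ (v ⊕ c))   ≡⟨ cong (d ⊕_) (sym (⊕-assoc v v c)) ⟩
  d ⊕ ((v ⊕ v) ⊕ c)   ≡⟨ cong (λ t → d ⊕ (t ⊕ c)) (⊕-self v) ⟩
  d ⊕ (z _ ⊕ c)       ≡⟨ cong (d ⊕_) (z-⊕ c) ⟩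
  d ⊕ c               ∎
  where open ≡-Reasoning

isZ : ∀ {n} → Vertex n → Bool
isZ [] = true
isZ (a ∷ x) = not a ∧ isZ x

isZ-z : ∀ n → isZ (z n) ≡ true
isZ-z zero = refl
isZ-z (suc n) = isZ-z n

isZ⇒z : ∀ {n} (x : Vertex n) → isZ x ≡ true → x ≡ z n
isZ⇒z [] _ = refl
isZ⇒z (false ∷ x) x≡0 = cong (false ∷_) (isZ⇒z x x≡0)
isZ⇒z (true ∷ x) ()

==ᵛ-isZ : ∀ {n} (x y : Vertex n) → (x ==ᵛ y) ≡ isZ (x ⊕ y)
==ᵛ-isZ {n} x y with VecP.≡-dec BoolP._≟_ x y | isZ (x ⊕ y) in eq
... | yes refl | true = refl
... | yes refl | false = trans (sym (trans (cong isZ (⊕-self x)) (isZ-z n))) eq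
... | no x≢y | true = ⊥-elim (x≢y (begin
  x              ≡⟨ sym (⊕-cancel x y) ⟩
  (x ⊕ y) ⊕ y    ≡⟨ cong (_⊕ y) (isZ⇒z (x ⊕ y) eq) ⟩
  z n ⊕ y        ≡⟨ z-⊕ y ⟩
  y              ∎))
  where open ≡-Reasoning
... | no _ | false = refl

Σv-translate : ∀ n (a : Vertex n) (f : Vertex n → ℚ) → Σv n (λ d → f (a ⊕ d)) ≡ Σv n f
Σv-translate zero [] f = refl
Σv-translate (suc n) (false ∷ a) f = begin
  Σv (suc n) (λ d → f ((false ∷ a) ⊕ d))
    ≡⟨ Σv-suc n _ ⟩
  Σv n (λ d → f (false ∷ (a ⊕ d))) + Σv n (λ d → f (true ∷ (a ⊕ d)))
    ≡⟨ cong₂ _+_ (Σv-translate n a (f ∘ (false ∷_))) (Σv-translate n a (f ∘ (true ∷_))) ⟩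
  Σv n (λ v → f (false ∷ v)) + Σv n (λ v → f (true ∷ v))
    ≡⟨ sym (Σv-suc n f) ⟩
  Σv (suc n) f ∎
  where open ≡-Reasoning
Σv-translate (suc n) (true ∷ a) f = begin
  Σv (suc n) (λ d → f ((true ∷ a) ⊕ d))
    ≡⟨ Σv-suc n _ ⟩
  Σv n (λ d → f (true ∷ (a ⊕ d))) + Σv n (λ d → f (false ∷ (a ⊕ d)))
    ≡⟨ cong₂ _+_ (Σv-translate n a (f ∘ (true ∷_))) (Σv-translate n a (f ∘ (false ∷_))) ⟩
  Σv n (λ v → f (true ∷ v)) + Σv n (λ v → f (false ∷ v))
    ≡⟨ QP.+-comm (Σv n (λ v → f (true ∷ v))) (Σv n (λ v → f (false ∷ v))) ⟩
  Σv n (λ v → f (false ∷ v)) + Σv n (λ v → f (true ∷ v))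
    ≡⟨ sym (Σv-suc n f) ⟩
  Σv (suc n) f ∎
  where open ≡-Reasoning

Σv-atZ : ∀ n (f : Vertex n → ℚ) → Σv n (λ v → if isZ v then f v else 0ℚ) ≡ f (z n)
Σv-atZ zero f = QP.+-identityʳ _
Σv-atZ (suc n) f = begin
  Σv (suc n) (λ v → if isZ v then f v else 0ℚ)
    ≡⟨ Σv-suc n _ ⟩
  Σv n (λ v → if isZ v then f (false ∷ v) else 0ℚ) + Σv n (λ _ → 0ℚ)
    ≡⟨ cong₂ _+_ (Σv-atZ n (f ∘ (false ∷_))) (sumL-0 (allVertices n)) ⟩
  f (z (suc n)) + 0ℚ
    ≡⟨ QP.+-identityʳ _ ⟩
  f (z (suc n)) ∎
  where open ≡-Reasoning

Σv-const : ∀ n (c : ℚ) → Σv n (λ _ → c) ≡ pow2 n * c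
Σv-const zero c = trans (QP.+-identityʳ c) (sym (QP.*-identityˡ c))
Σv-const (suc n) c = trans (Σv-suc n _)
  (trans (cong₂ _+_ (Σv-const n c) (Σv-const n c)) (sym (proj₂ QP.*-distrib-+ c (pow2 n) (pow2 n))))

sign : Bool → ℚ
sign true = - 1ℚ
sign false = 1ℚ

χ : ∀ {n} → Vertex n → Vertex n → ℚ
χ [] [] = 1ℚ
χ (s ∷ S) (v ∷ V) = sign (s ∧ v) * χ S V

sign-xor : ∀ s a b → sign (s ∧ (a xor b)) ≡ sign (s ∧ a) * sign (s ∧ b)
sign-xor false a b = refl
sign-xor true false b = sym (QP.*-identityˡ _)
sign-xor true true false = refl
sign-xor true true true = refl

χ-⊕ : ∀ {n} (S u w : Vertex n) → χ S (u ⊕ w) ≡ χ S u * χ S w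
χ-⊕ [] [] [] = refl
χ-⊕ (s ∷ S) (a ∷ u) (b ∷ w) = begin
  sign (s ∧ (a xor b)) * χ S (u ⊕ w)
    ≡⟨ cong₂ _*_ (sign-xor s a b) (χ-⊕ S u w) ⟩
  (sign (s ∧ a) * sign (s ∧ b)) * (χ S u * χ S w)
    ≡⟨ solve 4 (λ p q r t → (p :* q) :* (r :* t) := (p :* r) :* (q :* t)) refl (sign (s ∧ a)) (sign (s ∧ b)) (χ S u) (χ S w) ⟩
  (sign (s ∧ a) * χ S u) * (sign (s ∧ b) * χ S w) ∎
  where open ≡-Reasoning

χ-sym : ∀ {n} (S v : Vertex n) → χ S v ≡ χ v S
χ-sym [] [] = refl
χ-sym (s ∷ S) (v ∷ V) = cong₂ _*_ (cong sign (BoolP.∧-comm s v)) (χ-sym S V)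

χ-z : ∀ {n} (S : Vertex n) → χ S (z n) ≡ 1ℚ
χ-z [] = refl
χ-z (s ∷ S) = trans (cong (_* χ S (z _)) (cong sign (BoolP.∧-zeroʳ s))) (trans (QP.*-identityˡ _) (χ-z S))

orthogonality : ∀ n (u : Vertex n) → Σv n (λ S → χ S u) ≡ (if isZ u then pow2 n else 0ℚ)
orthogonality zero [] = QP.+-identityʳ _
orthogonality (suc n) (b ∷ u) = begin
  Σv (suc n) (λ S → χ S (b ∷ u))
    ≡⟨ Σv-suc n _ ⟩
  Σv n (λ S → 1ℚ * χ S u) + Σv n (λ S → sign b * χ S u)
    ≡⟨ cong₂ _+_ (sumL-*ˡ (allVertices n) 1ℚ (λ S → χ S u)) (sumL-*ˡ (allVertices n) (sign b) (λ S → χ S u)) ⟩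
  1ℚ * Σv n (λ S → χ S u) + sign b * Σv n (λ S → χ S u)
    ≡⟨ cong (λ t → 1ℚ * t + sign b * t) (orthogonality n u) ⟩
  1ℚ * I + sign b * I
    ≡⟨ combine b (isZ u) ⟩
  (if not b ∧ isZ u then pow2 (suc n) else 0ℚ) ∎
  where
  open ≡-Reasoning
  I : ℚ
  I = if isZ u then pow2 n else 0ℚ
  combine : ∀ b c → 1ℚ * (if c then pow2 n else 0ℚ) + sign b * (if c then pow2 n else 0ℚ)
                    ≡ (if not b ∧ c then pow2 (suc n) else 0ℚ)
  combine false true = solve 1 (λ p → con 1ℚ :* p :+ con 1ℚ :* p := p :+ p) refl (pow2 n)
  combine false false = refl
  combine true true = solve 1 (λ p → con 1ℚ :* p :+ (:- con 1ℚ) :* p := con 0ℚ) refl (pow2 n)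
  combine true false = refl

flipWhere : ∀ {n} → (Fin n → Bool) → Vertex n → Vertex n
flipWhere p x = tabulate λ i → if p i then not (lookup x i) else lookup x i

flipWhere-⊕ : ∀ n (p : Fin n → Bool) (v : Vertex n) → flipWhere p v ≡ v ⊕ flipWhere p (z n)
flipWhere-⊕ zero p [] = refl
flipWhere-⊕ (suc n) p (a ∷ v) = cong₂ _∷_ (head (p F.zero) a) (flipWhere-⊕ n (p ∘ F.suc) v)
  where
  head : ∀ c a → (if c then not a else a) ≡ a xor (if c then not false else false)
  head false false = refl
  head false true = refl
  head true false = refl
  head true true = refl

hamming-⊕ : ∀ {n} (v d : Vertex n) → hamming v (v ⊕ d) ≡ hamming (z n) d
hamming-⊕ [] [] = refl
hamming-⊕ (false ∷ v) (false ∷ d) = hamming-⊕ v d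
hamming-⊕ (false ∷ v) (true ∷ d) = cong suc (hamming-⊕ v d)
hamming-⊕ (true ∷ v) (false ∷ d) = hamming-⊕ v d
hamming-⊕ (true ∷ v) (true ∷ d) = cong suc (hamming-⊕ v d)

adjQ-translate : ∀ n k (v d : Vertex n) → adjQ n k v (v ⊕ d) ≡ adjQ n k (z n) d
adjQ-translate n k v d = cong₂ _∨_ (cong (λ h → ⌊ h ℕ.≟ 1 ⌋) (hamming-⊕ v d)) (begin
  ((v ⊕ d) ==ᵛ flipWhere p v)               ≡⟨ ==ᵛ-isZ (v ⊕ d) _ ⟩
  isZ ((v ⊕ d) ⊕ flipWhere p v)             ≡⟨ cong (λ t → isZ ((v ⊕ d) ⊕ t)) (flipWhere-⊕ n p v) ⟩
  isZ ((v ⊕ d) ⊕ (v ⊕ flipWhere p (z n)))   ≡⟨ cong isZ (⊕-translate v d _) ⟩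
  isZ (d ⊕ flipWhere p (z n))               ≡⟨ sym (==ᵛ-isZ d _) ⟩
  (d ==ᵛ flipWhere p (z n))                 ∎)
  where
  open ≡-Reasoning
  p : Fin n → Bool
  p i = k ℕ.≤ᵇ suc (F.toℕ i)

weight : ∀ n k → Vertex n → ℚ
weight n k d = if adjQ n k (z n) d then 1ℚ else 0ℚ

if-as-* : ∀ (b : Bool) (x : ℚ) → (if b then x else 0ℚ) ≡ (if b then 1ℚ else 0ℚ) * x
if-as-* false x = sym (QP.*-zeroˡ x)
if-as-* true x = sym (QP.*-identityˡ x)

laplacian-conv : ∀ n k (f : Vertex n → ℚ) (v : Vertex n) →
  laplacian n k f v ≡ Σv n (λ d → weight n k d * (f v - f (v ⊕ d)))
laplacian-conv n k f v = trans (sym (Σv-translate n v _)) (Σv-cong n λ d →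
  trans (cong (λ b → if b then f v - f (v ⊕ d) else 0ℚ) (adjQ-translate n k v d))
        (if-as-* (adjQ n k (z n) d) (f v - f (v ⊕ d))))

laplacian-- : ∀ n k (F H : Vertex n → ℚ) (u : Vertex n) →
  laplacian n k (λ v → F v - H v) u ≡ laplacian n k F u - laplacian n k H u
laplacian-- n k F H u = begin
  laplacian n k (λ v → F v - H v) u
    ≡⟨ laplacian-conv n k (λ v → F v - H v) u ⟩
  Σv n (λ d → w d * ((F u - H u) - (F (u ⊕ d) - H (u ⊕ d))))
    ≡⟨ Σv-cong n (λ d → solve 5 (λ w a b c e → w :* ((a :- b) :- (c :- e)) := w :* (a :- c) :- w :* (b :- e))
                                 refl (w d) (F u) (H u) (F (u ⊕ d)) (H (u ⊕ d))) ⟩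
  Σv n (λ d → w d * (F u - F (u ⊕ d)) - w d * (H u - H (u ⊕ d)))
    ≡⟨ sumL-- (allVertices n) _ _ ⟩
  Σv n (λ d → w d * (F u - F (u ⊕ d))) - Σv n (λ d → w d * (H u - H (u ⊕ d)))
    ≡⟨ sym (cong₂ _-_ (laplacian-conv n k F u) (laplacian-conv n k H u)) ⟩
  laplacian n k F u - laplacian n k H u ∎
  where
  open ≡-Reasoning
  w : Vertex n → ℚ
  w = weight n k

laplacian-* : ∀ n k (c : ℚ) (F : Vertex n → ℚ) (u : Vertex n) →
  laplacian n k (λ v → c * F v) u ≡ c * laplacian n k F u
laplacian-* n k c F u = begin
  laplacian n k (λ v → c * F v) u
    ≡⟨ laplacian-conv n k (λ v → c * F v) u ⟩
  Σv n (λ d → w d * (c * F u - c * F (u ⊕ d)))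
    ≡⟨ Σv-cong n (λ d → solve 4 (λ w c a b → w :* (c :* a :- c :* b) := c :* (w :* (a :- b))) refl (w d) c (F u) (F (u ⊕ d))) ⟩
  Σv n (λ d → c * (w d * (F u - F (u ⊕ d))))
    ≡⟨ sumL-*ˡ (allVertices n) c _ ⟩
  c * Σv n (λ d → w d * (F u - F (u ⊕ d)))
    ≡⟨ cong (c *_) (sym (laplacian-conv n k F u)) ⟩
  c * laplacian n k F u ∎
  where
  open ≡-Reasoning
  w : Vertex n → ℚ
  w = weight n k

laplacian-Σ : ∀ {A : Set} n k (xs : List A) (g : A → Vertex n → ℚ) (u : Vertex n) →
  laplacian n k (λ v → sumL xs (λ S → g S v)) u ≡ sumL xs (λ S → laplacian n k (g S) u)
laplacian-Σ n k xs g u = begin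
  laplacian n k (λ v → sumL xs (λ S → g S v)) u
    ≡⟨ laplacian-conv n k (λ v → sumL xs (λ S → g S v)) u ⟩
  Σv n (λ d → w d * (sumL xs (λ S → g S u) - sumL xs (λ S → g S (u ⊕ d))))
    ≡⟨ Σv-cong n (λ d → trans (cong (w d *_) (sym (sumL-- xs _ _))) (sym (sumL-*ˡ xs (w d) _))) ⟩
  Σv n (λ d → sumL xs (λ S → w d * (g S u - g S (u ⊕ d))))
    ≡⟨ fubini (allVertices n) xs _ ⟩
  sumL xs (λ S → Σv n (λ d → w d * (g S u - g S (u ⊕ d))))
    ≡⟨ sumL-cong xs (λ S → sym (laplacian-conv n k (g S) u)) ⟩
  sumL xs (λ S → laplacian n k (g S) u) ∎
  where
  open ≡-Reasoning
  w : Vertex n → ℚ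
  w = weight n k

laplacian-translate : ∀ n k (F : Vertex n → ℚ) (a v : Vertex n) →
  laplacian n k (λ w → F (w ⊕ a)) v ≡ laplacian n k F (v ⊕ a)
laplacian-translate n k F a v = trans (laplacian-conv n k (λ w → F (w ⊕ a)) v)
  (trans (Σv-cong n (λ d → cong (λ t → weight n k d * (F (v ⊕ a) - F t)) (swap d)))
         (sym (laplacian-conv n k F (v ⊕ a))))
  where
  swap : ∀ d → (v ⊕ d) ⊕ a ≡ (v ⊕ a) ⊕ d
  swap d = trans (⊕-assoc v d a) (trans (cong (v ⊕_) (⊕-comm d a)) (sym (⊕-assoc v a d)))

Λ : ∀ n k → Vertex n → ℚ
Λ n k S = Σv n (λ d → weight n k d * (1ℚ - χ S d))

laplacian-χ : ∀ n k (S v : Vertex n) → laplacian n k (χ S) v ≡ Λ n k S * χ S v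
laplacian-χ n k S v = begin
  laplacian n k (χ S) v
    ≡⟨ laplacian-conv n k (χ S) v ⟩
  Σv n (λ d → w d * (χ S v - χ S (v ⊕ d)))
    ≡⟨ Σv-cong n (λ d → trans (cong (λ t → w d * (χ S v - t)) (χ-⊕ S v d))
         (solve 3 (λ w a b → w :* (a :- a :* b) := (w :* (con 1ℚ :- b)) :* a) refl (w d) (χ S v) (χ S d))) ⟩
  Σv n (λ d → (w d * (1ℚ - χ S d)) * χ S v)
    ≡⟨ sumL-*ʳ (allVertices n) (χ S v) _ ⟩
  Λ n k S * χ S v ∎
  where
  open ≡-Reasoning
  w : Vertex n → ℚ
  w = weight n k

Λ-z : ∀ n k → Λ n k (z n) ≡ 0ℚ
Λ-z n k = trans (Σv-cong n (λ d → begin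
  weight n k d * (1ℚ - χ (z n) d)  ≡⟨ cong (λ t → weight n k d * (1ℚ - t)) (trans (χ-sym (z n) d) (χ-z d)) ⟩
  weight n k d * (1ℚ - 1ℚ)         ≡⟨ QP.*-zeroʳ (weight n k d) ⟩
  0ℚ                               ∎)) (sumL-0 (allVertices n))
  where open ≡-Reasoning

pairing-laplacian : ∀ n k (f g : Vertex n → ℚ) →
  Σv n (λ v → f v * laplacian n k g v)
    ≡ Σv n (λ v → Σv n (λ d → weight n k d * (f v * g v)))
      - Σv n (λ v → Σv n (λ d → weight n k d * (f v * g (v ⊕ d))))
pairing-laplacian n k f g = trans (Σv-cong n expand) (sumL-- (allVertices n) _ _)
  where
  open ≡-Reasoning
  w : Vertex n → ℚ
  w = weight n k
  expand : ∀ v → f v * laplacian n k g v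
                 ≡ Σv n (λ d → w d * (f v * g v)) - Σv n (λ d → w d * (f v * g (v ⊕ d)))
  expand v = begin
    f v * laplacian n k g v
      ≡⟨ cong (f v *_) (laplacian-conv n k g v) ⟩
    f v * Σv n (λ d → w d * (g v - g (v ⊕ d)))
      ≡⟨ sym (sumL-*ˡ (allVertices n) (f v) _) ⟩
    Σv n (λ d → f v * (w d * (g v - g (v ⊕ d))))
      ≡⟨ Σv-cong n (λ d → solve 4 (λ w a b c → a :* (w :* (b :- c)) := w :* (a :* b) :- w :* (a :* c))
                                  refl (w d) (f v) (g v) (g (v ⊕ d))) ⟩
    Σv n (λ d → w d * (f v * g v) - w d * (f v * g (v ⊕ d)))
      ≡⟨ sumL-- (allVertices n) _ _ ⟩
    Σv n (λ d → w d * (f v * g v)) - Σv n (λ d → w d * (f v * g (v ⊕ d))) ∎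

-- The cross part is symmetric in f and g, by the substitution v ↦ v ⊕ d.
cross-symmetric : ∀ n k (f g : Vertex n → ℚ) →
  Σv n (λ v → Σv n (λ d → weight n k d * (f v * g (v ⊕ d))))
    ≡ Σv n (λ v → Σv n (λ d → weight n k d * (g v * f (v ⊕ d))))
cross-symmetric n k f g = begin
  Σv n (λ v → Σv n (λ d → w d * (f v * g (v ⊕ d))))
    ≡⟨ fubini V V _ ⟩
  Σv n (λ d → Σv n (λ v → w d * (f v * g (v ⊕ d))))
    ≡⟨ Σv-cong n (λ d → trans (sym (Σv-translate n d (λ v → w d * (f v * g (v ⊕ d))))) (Σv-cong n (substitute d))) ⟩
  Σv n (λ d → Σv n (λ v → w d * (g v * f (v ⊕ d))))
    ≡⟨ fubini V V _ ⟩
  Σv n (λ v → Σv n (λ d → w d * (g v * f (v ⊕ d)))) ∎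
  where
  open ≡-Reasoning
  w : Vertex n → ℚ
  w = weight n k
  V : List (Vertex n)
  V = allVertices n
  substitute : ∀ d v → w d * (f (d ⊕ v) * g ((d ⊕ v) ⊕ d)) ≡ w d * (g v * f (v ⊕ d))
  substitute d v = cong (w d *_) (trans
    (cong₂ (λ s t → f s * g t) (⊕-comm d v) (trans (cong (_⊕ d) (⊕-comm d v)) (⊕-cancel v d)))
    (QP.*-comm (f (v ⊕ d)) (g v)))

laplacian-selfAdjoint : ∀ n k (f g : Vertex n → ℚ) →
  Σv n (λ v → f v * laplacian n k g v) ≡ Σv n (λ v → g v * laplacian n k f v)
laplacian-selfAdjoint n k f g = begin
  Σv n (λ v → f v * laplacian n k g v)
    ≡⟨ pairing-laplacian n k f g ⟩
  Σv n (λ v → Σv n (λ d → weight n k d * (f v * g v)))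
    - Σv n (λ v → Σv n (λ d → weight n k d * (f v * g (v ⊕ d))))
    ≡⟨ cong₂ _-_ (Σv-cong n (λ v → Σv-cong n (λ d → cong (weight n k d *_) (QP.*-comm (f v) (g v)))))
                 (cross-symmetric n k f g) ⟩
  Σv n (λ v → Σv n (λ d → weight n k d * (g v * f v)))
    - Σv n (λ v → Σv n (λ d → weight n k d * (g v * f (v ⊕ d))))
    ≡⟨ sym (pairing-laplacian n k g f) ⟩
  Σv n (λ v → g v * laplacian n k f v) ∎
  where open ≡-Reasoning

pairing-indicator : ∀ n (f : Vertex n → ℚ) a → Σv n (λ v → f v * indicator a v) ≡ f a
pairing-indicator n f a = begin
  Σv n (λ v → f v * indicator a v)
    ≡⟨ sym (Σv-translate n a _) ⟩
  Σv n (λ d → f (a ⊕ d) * indicator a (a ⊕ d))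
    ≡⟨ Σv-cong n (λ d → trans (cong (λ t → f (a ⊕ d) * (if t then 1ℚ else 0ℚ)) (test d))
                              (trans (QP.*-comm (f (a ⊕ d)) _) (sym (if-as-* (isZ d) (f (a ⊕ d)))))) ⟩
  Σv n (λ d → if isZ d then f (a ⊕ d) else 0ℚ)
    ≡⟨ Σv-atZ n (λ d → f (a ⊕ d)) ⟩
  f (a ⊕ z n)
    ≡⟨ cong f (⊕-z a) ⟩
  f a ∎
  where
  open ≡-Reasoning
  test : ∀ d → ((a ⊕ d) ==ᵛ a) ≡ isZ d
  test d = trans (==ᵛ-isZ (a ⊕ d) a) (cong isZ (trans (cong (_⊕ a) (⊕-comm a d)) (⊕-cancel d a)))

pairing-source : ∀ n (f : Vertex n → ℚ) a b →
  Σv n (λ v → f v * (indicator a v - indicator b v)) ≡ f a - f b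
pairing-source n f a b = trans
  (Σv-cong n (λ v → solve 3 (λ x p q → x :* (p :- q) := x :* p :- x :* q) refl (f v) (indicator a v) (indicator b v)))
  (trans (sumL-- (allVertices n) _ _) (cong₂ _-_ (pairing-indicator n f a) (pairing-indicator n f b)))

-- Effective resistances do not depend on the choice of potentials: with
-- L φ = L φ′ = e_a - e_b, self-adjointness gives ⟨φ, e_a - e_b⟩ = ⟨φ′, e_a - e_b⟩.
resistance-unique : ∀ n k (φ φ′ : Vertex n → Vertex n → Vertex n → ℚ) →
  IsPotentialFamily n k φ → IsPotentialFamily n k φ′ → ∀ a b → resistance φ a b ≡ resistance φ′ a b
resistance-unique n k φ φ′ φ-pot φ′-pot a b = begin
  φ a b a - φ a b b
    ≡⟨ sym (pairing-source n (φ a b) a b) ⟩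
  Σv n (λ v → φ a b v * (indicator a v - indicator b v))
    ≡⟨ Σv-cong n (λ v → cong (φ a b v *_) (sym (φ′-pot a b v))) ⟩
  Σv n (λ v → φ a b v * laplacian n k (φ′ a b) v)
    ≡⟨ laplacian-selfAdjoint n k (φ a b) (φ′ a b) ⟩
  Σv n (λ v → φ′ a b v * laplacian n k (φ a b) v)
    ≡⟨ Σv-cong n (λ v → cong (φ′ a b v *_) (φ-pot a b v)) ⟩
  Σv n (λ v → φ′ a b v * (indicator a v - indicator b v))
    ≡⟨ pairing-source n (φ′ a b) a b ⟩
  φ′ a b a - φ′ a b b ∎
  where open ≡-Reasoning

-- Spectral form of connectedness: only the trivial character has eigenvalue 0.
SpectralGap : ℕ → ℕ → Set
SpectralGap n k = ∀ S → isZ S ≡ false → ¬ (Λ n k S ≡ 0ℚ)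

inv-Λ : ∀ n k → SpectralGap n k → ∀ S → inv (Λ n k S) * Λ n k S ≡ (if isZ S then 0ℚ else 1ℚ)
inv-Λ n k gap S with isZ S in S-test
... | true = cong (λ t → inv t * t) (trans (cong (Λ n k) (isZ⇒z S S-test)) (Λ-z n k))
... | false = trans (QP.*-comm (inv (Λ n k S)) (Λ n k S)) (*-inv (Λ n k S) (gap S S-test))

spectralSum : ℕ → ℕ → ℚ
spectralSum n k = Σv n (λ S → inv (Λ n k S))

module Green (n k : ℕ) (gap : SpectralGap n k) where

  N : ℚ
  N = pow2 n
  c : ℚ
  c = inv N

  c*N : c * N ≡ 1ℚ
  c*N = trans (QP.*-comm c N) (*-inv N (pow2≢0 n))

  G : Vertex n → ℚ
  G v = c * Σv n (λ S → inv (Λ n k S) * χ S v)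

  laplacian-G : ∀ u → laplacian n k G u ≡ c * ((if isZ u then N else 0ℚ) - 1ℚ)
  laplacian-G u = begin
    laplacian n k G u
      ≡⟨ laplacian-* n k c (λ v → Σv n (λ S → inv (Λ n k S) * χ S v)) u ⟩
    c * laplacian n k (λ v → Σv n (λ S → inv (Λ n k S) * χ S v)) u
      ≡⟨ cong (c *_) (laplacian-Σ n k (allVertices n) (λ S v → inv (Λ n k S) * χ S v) u) ⟩
    c * Σv n (λ S → laplacian n k (λ v → inv (Λ n k S) * χ S v) u)
      ≡⟨ cong (c *_) (Σv-cong n (λ S → trans (laplacian-* n k (inv (Λ n k S)) (χ S) u)
                                             (cong (inv (Λ n k S) *_) (laplacian-χ n k S u)))) ⟩
    c * Σv n (λ S → inv (Λ n k S) * (Λ n k S * χ S u))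
      ≡⟨ cong (c *_) (Σv-cong n (λ S → trans (sym (QP.*-assoc (inv (Λ n k S)) (Λ n k S) (χ S u)))
                                  (trans (cong (_* χ S u) (inv-Λ n k gap S)) (project (isZ S) (χ S u))))) ⟩
    c * Σv n (λ S → χ S u - (if isZ S then χ S u else 0ℚ))
      ≡⟨ cong (c *_) (sumL-- (allVertices n) _ _) ⟩
    c * (Σv n (λ S → χ S u) - Σv n (λ S → if isZ S then χ S u else 0ℚ))
      ≡⟨ cong (c *_) (cong₂ _-_ (orthogonality n u)
                                (trans (Σv-atZ n (λ S → χ S u)) (trans (χ-sym (z n) u) (χ-z u)))) ⟩
    c * ((if isZ u then N else 0ℚ) - 1ℚ) ∎
    where
    open ≡-Reasoning
    project : ∀ b x → (if b then 0ℚ else 1ℚ) * x ≡ x - (if b then x else 0ℚ)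
    project true x = solve 1 (λ x → con 0ℚ :* x := x :- x) refl x
    project false x = solve 1 (λ x → con 1ℚ :* x := x :- con 0ℚ) refl x

  ψ : Vertex n → Vertex n → Vertex n → ℚ
  ψ a b v = G (v ⊕ a) - G (v ⊕ b)

  -- The constant parts of L G(· ⊕ a) and L G(· ⊕ b) cancel.
  ψ-potential : IsPotentialFamily n k ψ
  ψ-potential a b v = begin
    laplacian n k (ψ a b) v
      ≡⟨ laplacian-- n k (λ w → G (w ⊕ a)) (λ w → G (w ⊕ b)) v ⟩
    laplacian n k (λ w → G (w ⊕ a)) v - laplacian n k (λ w → G (w ⊕ b)) v
      ≡⟨ cong₂ _-_ (laplacian-translate n k G a v) (laplacian-translate n k G b v) ⟩
    laplacian n k G (v ⊕ a) - laplacian n k G (v ⊕ b)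
      ≡⟨ cong₂ _-_ (laplacian-G (v ⊕ a)) (laplacian-G (v ⊕ b)) ⟩
    c * ((if isZ (v ⊕ a) then N else 0ℚ) - 1ℚ) - c * ((if isZ (v ⊕ b) then N else 0ℚ) - 1ℚ)
      ≡⟨ cancel (isZ (v ⊕ a)) (isZ (v ⊕ b)) ⟩
    (if isZ (v ⊕ a) then 1ℚ else 0ℚ) - (if isZ (v ⊕ b) then 1ℚ else 0ℚ)
      ≡⟨ sym (cong₂ (λ s t → (if s then 1ℚ else 0ℚ) - (if t then 1ℚ else 0ℚ)) (==ᵛ-isZ v a) (==ᵛ-isZ v b)) ⟩
    indicator a v - indicator b v ∎
    where
    open ≡-Reasoning
    cancel : ∀ p q → c * ((if p then N else 0ℚ) - 1ℚ) - c * ((if q then N else 0ℚ) - 1ℚ)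
                     ≡ (if p then 1ℚ else 0ℚ) - (if q then 1ℚ else 0ℚ)
    cancel true true = solve 2 (λ c N → c :* (N :- con 1ℚ) :- c :* (N :- con 1ℚ) := con 1ℚ :- con 1ℚ) refl c N
    cancel false false = solve 1 (λ c → c :* (con 0ℚ :- con 1ℚ) :- c :* (con 0ℚ :- con 1ℚ) := con 0ℚ :- con 0ℚ) refl c
    cancel true false = trans (solve 2 (λ c N → c :* (N :- con 1ℚ) :- c :* (con 0ℚ :- con 1ℚ) := c :* N :- con 0ℚ) refl c N)
                              (cong (_- 0ℚ) c*N)
    cancel false true = trans (solve 2 (λ c N → c :* (con 0ℚ :- con 1ℚ) :- c :* (N :- con 1ℚ) := con 0ℚ :- c :* N) refl c N)
                              (cong (λ t → 0ℚ - t) c*N)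

  G-z : G (z n) ≡ c * spectralSum n k
  G-z = cong (c *_) (Σv-cong n (λ S → trans (cong (inv (Λ n k S) *_) (χ-z S)) (QP.*-identityʳ _)))

  -- G has mean zero: only the trivial character survives, with weight 0⁻¹ = 0.
  Σv-G : Σv n G ≡ 0ℚ
  Σv-G = begin
    Σv n G
      ≡⟨ sumL-*ˡ V c _ ⟩
    c * Σv n (λ v → Σv n (λ S → inv (Λ n k S) * χ S v))
      ≡⟨ cong (c *_) (fubini V V _) ⟩
    c * Σv n (λ S → Σv n (λ v → inv (Λ n k S) * χ S v))
      ≡⟨ cong (c *_) (Σv-cong n (λ S → trans (sumL-*ˡ V (inv (Λ n k S)) (χ S))
           (cong (inv (Λ n k S) *_) (trans (Σv-cong n (χ-sym S)) (orthogonality n S))))) ⟩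
    c * Σv n (λ S → inv (Λ n k S) * (if isZ S then N else 0ℚ))
      ≡⟨ cong (c *_) (Σv-cong n (λ S → pull (isZ S) (inv (Λ n k S)))) ⟩
    c * Σv n (λ S → if isZ S then inv (Λ n k S) * N else 0ℚ)
      ≡⟨ cong (c *_) (Σv-atZ n (λ S → inv (Λ n k S) * N)) ⟩
    c * (inv (Λ n k (z n)) * N)
      ≡⟨ cong (λ t → c * (inv t * N)) (Λ-z n k) ⟩
    c * (inv 0ℚ * N)
      ≡⟨ solve 2 (λ c N → c :* (con 0ℚ :* N) := con 0ℚ) refl c N ⟩
    0ℚ ∎
    where
    open ≡-Reasoning
    V : List (Vertex n)
    V = allVertices n
    pull : ∀ b x → x * (if b then N else 0ℚ) ≡ (if b then x * N else 0ℚ)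
    pull true x = refl
    pull false x = QP.*-zeroʳ x

  ρ : Vertex n → Vertex n → ℚ
  ρ a b = ι 2 * G (z n) - ι 2 * G (a ⊕ b)

  resistance-ψ : ∀ a b → resistance ψ a b ≡ ρ a b
  resistance-ψ a b = begin
    (G (a ⊕ a) - G (a ⊕ b)) - (G (b ⊕ a) - G (b ⊕ b))
      ≡⟨ cong₂ (λ s t → (G s - G (a ⊕ b)) - (G t - G (b ⊕ b))) (⊕-self a) (⊕-comm b a) ⟩
    (G (z n) - G (a ⊕ b)) - (G (a ⊕ b) - G (b ⊕ b))
      ≡⟨ cong (λ t → (G (z n) - G (a ⊕ b)) - (G (a ⊕ b) - G t)) (⊕-self b) ⟩
    (G (z n) - G (a ⊕ b)) - (G (a ⊕ b) - G (z n))
      ≡⟨ solve 2 (λ x y → (x :- y) :- (y :- x) := con (ι 2) :* x :- con (ι 2) :* y) refl (G (z n)) (G (a ⊕ b)) ⟩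
    ρ a b ∎
    where open ≡-Reasoning

  ρ-row : ∀ a → Σv n (ρ a) ≡ N * (ι 2 * G (z n)) - ι 2 * 0ℚ
  ρ-row a = trans (sumL-- (allVertices n) _ _) (cong₂ _-_ (Σv-const n _)
    (trans (sumL-*ˡ (allVertices n) (ι 2) _) (cong (ι 2 *_) (trans (Σv-translate n a G) Σv-G))))

  ρ-diagonal : ∀ a → ρ a a ≡ 0ℚ
  ρ-diagonal a = trans (cong (λ t → ι 2 * G (z n) - ι 2 * G t) (⊕-self a)) (QP.+-inverseʳ (ι 2 * G (z n)))

  kirchhoff-ψ : kirchhoffIndex n ψ ≡ N * spectralSum n k
  kirchhoff-ψ = *-cancelˡ (ι 2) _ _ (ι-suc≢0 1) (begin
    ι 2 * kirchhoffIndex n ψ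
      ≡⟨ cong (ι 2 *_) (sumL-cong (pairs V) (λ p → resistance-ψ (proj₁ p) (proj₂ p))) ⟩
    ι 2 * sumL (pairs V) (λ p → ρ (proj₁ p) (proj₂ p))
      ≡⟨ pairs-sum V ρ (λ a b → cong (λ t → ι 2 * G (z n) - ι 2 * G t) (⊕-comm a b)) ⟩
    Σv n (λ a → Σv n (ρ a)) - Σv n (λ a → ρ a a)
      ≡⟨ cong₂ _-_ (Σv-cong n ρ-row) (trans (Σv-cong n ρ-diagonal) (sumL-0 V)) ⟩
    Σv n (λ a → N * (ι 2 * G (z n)) - ι 2 * 0ℚ) - 0ℚ
      ≡⟨ cong (_- 0ℚ) (Σv-const n _) ⟩
    N * (N * (ι 2 * G (z n)) - ι 2 * 0ℚ) - 0ℚ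
      ≡⟨ cong (λ t → N * (N * (ι 2 * t) - ι 2 * 0ℚ) - 0ℚ) G-z ⟩
    N * (N * (ι 2 * (c * σ)) - ι 2 * 0ℚ) - 0ℚ
      ≡⟨ solve 4 (λ N c s two → N :* (N :* (two :* (c :* s)) :- two :* con 0ℚ) :- con 0ℚ
                                := two :* ((c :* N) :* (N :* s))) refl N c σ (ι 2) ⟩
    ι 2 * ((c * N) * (N * σ))
      ≡⟨ cong (λ t → ι 2 * (t * (N * σ))) c*N ⟩
    ι 2 * (1ℚ * (N * σ))
      ≡⟨ cong (ι 2 *_) (QP.*-identityˡ (N * σ)) ⟩
    ι 2 * (N * σ) ∎)
    where
    open ≡-Reasoning
    V : List (Vertex n)
    V = allVertices n
    σ : ℚ
    σ = spectralSum n k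

kirchhoff-spectral : ∀ n k → SpectralGap n k → ∀ φ → IsPotentialFamily n k φ →
  kirchhoffIndex n φ ≡ pow2 n * spectralSum n k
kirchhoff-spectral n k gap φ φ-pot = trans
  (sumL-cong (pairs (allVertices n))
    (λ p → resistance-unique n k φ ψ φ-pot ψ-potential (proj₁ p) (proj₂ p)))
  kirchhoff-ψ
  where open Green n k gap

-- The graph Q_{m+2,m+1}: its connection set consists of the unit vectors and 0…011.
weightQ : ∀ m → Vertex (suc (suc m)) → ℚ
weightQ m = weight (suc (suc m)) (suc m)

ΛQ : ∀ m → Vertex (suc (suc m)) → ℚ
ΛQ m = Λ (suc (suc m)) (suc m)

suc≟1 : ∀ h → ⌊ suc h ℕ.≟ 1 ⌋ ≡ (h ℕ.≡ᵇ 0)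
suc≟1 zero = refl
suc≟1 (suc h) = refl

hamming-z≡0 : ∀ {n} (d : Vertex n) → (hamming (z n) d ℕ.≡ᵇ 0) ≡ isZ d
hamming-z≡0 [] = refl
hamming-z≡0 (false ∷ d) = hamming-z≡0 d
hamming-z≡0 (true ∷ d) = refl

weightQ-false : ∀ m (d : Vertex (suc (suc m))) → weightQ (suc m) (false ∷ d) ≡ weightQ m d
weightQ-false m d = cong (λ b → if b then 1ℚ else 0ℚ)
  (trans (cong (λ t → ⌊ hamming (z _) d ℕ.≟ 1 ⌋ ∨ t) (==ᵛ-isZ (false ∷ d) _))
         (sym (cong (λ t → ⌊ hamming (z _) d ℕ.≟ 1 ⌋ ∨ t) (==ᵛ-isZ d _))))

weightQ-true : ∀ m (d : Vertex (suc (suc m))) → weightQ (suc m) (true ∷ d) ≡ (if isZ d then 1ℚ else 0ℚ)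
weightQ-true m d = cong (λ b → if b then 1ℚ else 0ℚ)
  (trans (cong₂ _∨_ (trans (suc≟1 (hamming (z _) d)) (hamming-z≡0 d))
                    (==ᵛ-isZ (true ∷ d) (complementFrom (suc (suc m)) (z (suc (suc (suc m)))))))
         (BoolP.∨-identityʳ (isZ d)))

ΛQ-step : ∀ m (b : Bool) (S : Vertex (suc (suc m))) → ΛQ (suc m) (b ∷ S) ≡ ΛQ m S + (1ℚ - sign b * 1ℚ)
ΛQ-step m b S = begin
  ΛQ (suc m) (b ∷ S)
    ≡⟨ Σv-suc n (λ d → weightQ (suc m) d * (1ℚ - χ (b ∷ S) d)) ⟩
  Σv n (λ d → weightQ (suc m) (false ∷ d) * (1ℚ - sign (b ∧ false) * χ S d))
    + Σv n (λ d → weightQ (suc m) (true ∷ d) * (1ℚ - sign (b ∧ true) * χ S d))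
    ≡⟨ cong₂ _+_ (Σv-cong n (λ d → cong₂ (λ w t → w * (1ℚ - sign t * χ S d)) (weightQ-false m d) (BoolP.∧-zeroʳ b)))
                 (Σv-cong n (λ d → cong₂ (λ w t → w * (1ℚ - sign t * χ S d)) (weightQ-true m d) (BoolP.∧-identityʳ b))) ⟩
  Σv n (λ d → weightQ m d * (1ℚ - 1ℚ * χ S d))
    + Σv n (λ d → (if isZ d then 1ℚ else 0ℚ) * (1ℚ - sign b * χ S d))
    ≡⟨ cong₂ _+_ (Σv-cong n (λ d → cong (λ t → weightQ m d * (1ℚ - t)) (QP.*-identityˡ (χ S d))))
                 (trans (Σv-cong n (λ d → sym (if-as-* (isZ d) (1ℚ - sign b * χ S d))))
                        (Σv-atZ n (λ d → 1ℚ - sign b * χ S d))) ⟩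
  ΛQ m S + (1ℚ - sign b * χ S (z n))
    ≡⟨ cong (λ t → ΛQ m S + (1ℚ - sign b * t)) (χ-z S) ⟩
  ΛQ m S + (1ℚ - sign b * 1ℚ) ∎
  where
  open ≡-Reasoning
  n : ℕ
  n = suc (suc m)

ν : ∀ m → Vertex (suc (suc m)) → ℕ
ν zero (a ∷ b ∷ []) = if a ∨ b then 4 else 0
ν (suc m) (b ∷ S) = (if b then 2 else 0) ℕ.+ ν m S

ΛQ-ν : ∀ m (S : Vertex (suc (suc m))) → ΛQ m S ≡ ι (ν m S)
ΛQ-ν zero (false ∷ false ∷ []) = refl
ΛQ-ν zero (false ∷ true ∷ []) = refl
ΛQ-ν zero (true ∷ false ∷ []) = refl
ΛQ-ν zero (true ∷ true ∷ []) = refl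
ΛQ-ν (suc m) (false ∷ S) = trans (ΛQ-step m false S) (trans (cong (λ t → t + (1ℚ - 1ℚ * 1ℚ)) (ΛQ-ν m S)) (QP.+-identityʳ _))
ΛQ-ν (suc m) (true ∷ S) = trans (ΛQ-step m true S) (trans (cong (λ t → t + (1ℚ - (- 1ℚ) * 1ℚ)) (ΛQ-ν m S))
  (trans (QP.+-comm (ι (ν m S)) (ι 2)) (sym (ι-+ 2 (ν m S)))))

ν≡0 : ∀ m (S : Vertex (suc (suc m))) → (ν m S ℕ.≡ᵇ 0) ≡ isZ S
ν≡0 zero (false ∷ false ∷ []) = refl
ν≡0 zero (false ∷ true ∷ []) = refl
ν≡0 zero (true ∷ false ∷ []) = refl
ν≡0 zero (true ∷ true ∷ []) = refl
ν≡0 (suc m) (false ∷ S) = ν≡0 m S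
ν≡0 (suc m) (true ∷ S) = refl

gapQ : ∀ m → SpectralGap (suc (suc m)) (suc m)
gapQ m S S≢0 ΛS≡0 = ι≢0 (ν m S) {{record { nonZero = nonZero }}} (trans (sym (ΛQ-ν m S)) ΛS≡0)
  where
  nonZero : T (not (ν m S ℕ.≡ᵇ 0))
  nonZero = subst (T ∘ not) (sym (trans (ν≡0 m S) S≢0)) tt

-- Binomial sums binomSum m f = Σᵢ C(m,i) f(i), via Pascal's rule.
binomSum : ℕ → (ℕ → ℚ) → ℚ
binomSum zero f = f 0
binomSum (suc m) f = binomSum m f + binomSum m (f ∘ suc)

binomSum-cong : ∀ m {f g : ℕ → ℚ} → (∀ i → f i ≡ g i) → binomSum m f ≡ binomSum m g
binomSum-cong zero f≗g = f≗g 0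
binomSum-cong (suc m) f≗g = cong₂ _+_ (binomSum-cong m f≗g) (binomSum-cong m (f≗g ∘ suc))

binomSum-+ : ∀ m (f g : ℕ → ℚ) → binomSum m (λ i → f i + g i) ≡ binomSum m f + binomSum m g
binomSum-+ zero f g = refl
binomSum-+ (suc m) f g = trans (cong₂ _+_ (binomSum-+ m f g) (binomSum-+ m (f ∘ suc) (g ∘ suc)))
  (solve 4 (λ a b c d → (a :+ b) :+ (c :+ d) := (a :+ c) :+ (b :+ d)) refl
    (binomSum m f) (binomSum m g) (binomSum m (f ∘ suc)) (binomSum m (g ∘ suc)))

binomSum-- : ∀ m (f g : ℕ → ℚ) → binomSum m (λ i → f i - g i) ≡ binomSum m f - binomSum m g
binomSum-- zero f g = refl
binomSum-- (suc m) f g = trans (cong₂ _+_ (binomSum-- m f g) (binomSum-- m (f ∘ suc) (g ∘ suc)))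
  (solve 4 (λ a b c d → (a :- b) :+ (c :- d) := (a :+ c) :- (b :+ d)) refl
    (binomSum m f) (binomSum m g) (binomSum m (f ∘ suc)) (binomSum m (g ∘ suc)))

binomSum-* : ∀ m (c : ℚ) (f : ℕ → ℚ) → binomSum m (λ i → c * f i) ≡ c * binomSum m f
binomSum-* zero c f = refl
binomSum-* (suc m) c f = trans (cong₂ _+_ (binomSum-* m c f) (binomSum-* m c (f ∘ suc)))
  (sym (proj₁ QP.*-distrib-+ c _ _))

binomSum-1 : ∀ m → binomSum m (λ _ → 1ℚ) ≡ pow2 m
binomSum-1 zero = refl
binomSum-1 (suc m) = cong₂ _+_ (binomSum-1 m) (binomSum-1 m)

binomSum-0 : ∀ m → binomSum m (λ _ → 0ℚ) ≡ 0ℚ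
binomSum-0 zero = refl
binomSum-0 (suc m) = cong₂ _+_ (binomSum-0 m) (binomSum-0 m)

binomSum-δ₀ : ∀ m → binomSum m (λ i → if i ℕ.≡ᵇ 0 then 1ℚ else 0ℚ) ≡ 1ℚ
binomSum-δ₀ zero = refl
binomSum-δ₀ (suc m) = trans (cong₂ _+_ (binomSum-δ₀ m) (binomSum-0 m)) (QP.+-identityʳ 1ℚ)

-- Absorption i·C(m+1,i) = (m+1)·C(m,i-1).
binomSum-absorb : ∀ m (h : ℕ → ℚ) → binomSum (suc m) (λ i → ι i * h i) ≡ ι (suc m) * binomSum m (h ∘ suc)
binomSum-absorb zero h = solve 2 (λ a b → con (ι 0) :* a :+ con (ι 1) :* b := con (ι 1) :* b) refl (h 0) (h 1)
binomSum-absorb (suc m) h = begin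
  binomSum (suc m) (λ i → ι i * h i) + binomSum (suc m) (λ i → ι (suc i) * h (suc i))
    ≡⟨ cong₂ _+_ (binomSum-absorb m h) shifted ⟩
  j * B₁ + (W + j * B₂)
    ≡⟨ solve 4 (λ j a b w → j :* a :+ (w :+ j :* b) := (con 1ℚ :+ j) :* w :+ (j :* (a :+ b) :- j :* w)) refl j B₁ B₂ W ⟩
  (1ℚ + j) * W + (j * W - j * W)
    ≡⟨ trans (cong (λ t → (1ℚ + j) * W + t) (QP.+-inverseʳ (j * W))) (QP.+-identityʳ _) ⟩
  (1ℚ + j) * W
    ≡⟨ cong (_* W) (sym (ι-suc (suc m))) ⟩
  ι (suc (suc m)) * W ∎
  where
  open ≡-Reasoning
  j : ℚ
  j = ι (suc m)
  B₁ : ℚ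
  B₁ = binomSum m (h ∘ suc)
  B₂ : ℚ
  B₂ = binomSum m (h ∘ suc ∘ suc)
  W : ℚ
  W = binomSum (suc m) (h ∘ suc)
  shifted : binomSum (suc m) (λ i → ι (suc i) * h (suc i)) ≡ W + j * B₂
  shifted = begin
    binomSum (suc m) (λ i → ι (suc i) * h (suc i))
      ≡⟨ binomSum-cong (suc m) (λ i → trans (cong (_* h (suc i)) (ι-suc i))
           (solve 2 (λ a b → (con 1ℚ :+ a) :* b := b :+ a :* b) refl (ι i) (h (suc i)))) ⟩
    binomSum (suc m) (λ i → h (suc i) + ι i * h (suc i))
      ≡⟨ binomSum-+ (suc m) (h ∘ suc) (λ i → ι i * h (suc i)) ⟩
    W + binomSum (suc m) (λ i → ι i * h (suc i))
      ≡⟨ cong (λ t → W + t) (binomSum-absorb m (h ∘ suc)) ⟩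
    W + j * B₂ ∎

-- The spectral sum of Q_{m+2,m+1} as a binomial sum: the first m coordinates
-- contribute 2i, the last two contribute 0 once and 4 three times.
Σv-ν : ∀ m (g : ℕ → ℚ) →
  Σv (suc (suc m)) (λ S → g (ν m S)) ≡ binomSum m (λ i → g (2 ℕ.* i) + ι 3 * g (2 ℕ.* i ℕ.+ 4))
Σv-ν zero g = solve 2 (λ a b → a :+ (b :+ (b :+ (b :+ con 0ℚ))) := a :+ con (ι 3) :* b) refl (g 0) (g 4)
Σv-ν (suc m) g = begin
  Σv (suc (suc (suc m))) (λ S → g (ν (suc m) S))
    ≡⟨ Σv-suc (suc (suc m)) _ ⟩
  Σv (suc (suc m)) (λ S → g (ν m S)) + Σv (suc (suc m)) (λ S → g (2 ℕ.+ ν m S))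
    ≡⟨ cong₂ _+_ (Σv-ν m g) (Σv-ν m (λ j → g (2 ℕ.+ j))) ⟩
  binomSum m H + binomSum m (λ i → g (2 ℕ.+ 2 ℕ.* i) + ι 3 * g (2 ℕ.+ (2 ℕ.* i ℕ.+ 4)))
    ≡⟨ cong (λ t → binomSum m H + t) (binomSum-cong m (λ i → cong₂ (λ s t → g s + ι 3 * g t)
         (sym (ℕP.*-suc 2 i)) (trans (sym (ℕP.+-assoc 2 (2 ℕ.* i) 4)) (cong (ℕ._+ 4) (sym (ℕP.*-suc 2 i)))))) ⟩
  binomSum m H + binomSum m (H ∘ suc) ∎
  where
  open ≡-Reasoning
  H : ℕ → ℚ
  H i = g (2 ℕ.* i) + ι 3 * g (2 ℕ.* i ℕ.+ 4)

-- Reciprocal binomial sums Σᵢ C(m,i)/(i+j), with 1/0 read as 0.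
recipSum : ℕ → ℕ → ℚ
recipSum j m = binomSum m (λ i → inv (ι (j ℕ.+ i)))

recipSum₁-closed : ∀ m → ι (suc m) * recipSum 1 m ≡ pow2 (suc m) - 1ℚ
recipSum₁-closed m = begin
  ι (suc m) * recipSum 1 m
    ≡⟨ sym (binomSum-absorb m (λ i → inv (ι i))) ⟩
  binomSum (suc m) (λ i → ι i * inv (ι i))
    ≡⟨ binomSum-cong (suc m) (λ i → trans (QP.*-comm (ι i) (inv (ι i))) (trans (inv-ι* i) (complement i))) ⟩
  binomSum (suc m) (λ i → 1ℚ - (if i ℕ.≡ᵇ 0 then 1ℚ else 0ℚ))
    ≡⟨ binomSum-- (suc m) _ _ ⟩
  binomSum (suc m) (λ _ → 1ℚ) - binomSum (suc m) (λ i → if i ℕ.≡ᵇ 0 then 1ℚ else 0ℚ)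
    ≡⟨ cong₂ _-_ (binomSum-1 (suc m)) (binomSum-δ₀ (suc m)) ⟩
  pow2 (suc m) - 1ℚ ∎
  where
  open ≡-Reasoning
  complement : ∀ i → (if i ℕ.≡ᵇ 0 then 0ℚ else 1ℚ) ≡ 1ℚ - (if i ℕ.≡ᵇ 0 then 1ℚ else 0ℚ)
  complement zero = refl
  complement (suc i) = refl

-- (m+1) Σᵢ C(m,i)/(i+2) = 2^{m+1} - Σᵢ C(m+1,i)/(i+1), since i/(i+1) = 1 - 1/(i+1).
recipSum₂-step : ∀ m → ι (suc m) * recipSum 2 m ≡ pow2 (suc m) - recipSum 1 (suc m)
recipSum₂-step m = begin
  ι (suc m) * recipSum 2 m
    ≡⟨ sym (binomSum-absorb m (λ i → inv (ι (suc i)))) ⟩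
  binomSum (suc m) (λ i → ι i * inv (ι (suc i)))
    ≡⟨ binomSum-cong (suc m) complement ⟩
  binomSum (suc m) (λ i → 1ℚ - inv (ι (suc i)))
    ≡⟨ binomSum-- (suc m) _ _ ⟩
  binomSum (suc m) (λ _ → 1ℚ) - recipSum 1 (suc m)
    ≡⟨ cong (_- recipSum 1 (suc m)) (binomSum-1 (suc m)) ⟩
  pow2 (suc m) - recipSum 1 (suc m) ∎
  where
  open ≡-Reasoning
  complement : ∀ i → ι i * inv (ι (suc i)) ≡ 1ℚ - inv (ι (suc i))
  complement i = begin
    ι i * y                   ≡⟨ solve 2 (λ a y → a :* y := (con 1ℚ :+ a) :* y :- y) refl (ι i) y ⟩
    (1ℚ + ι i) * y - y        ≡⟨ cong (λ t → t * y - y) (sym (ι-suc i)) ⟩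
    ι (suc i) * y - y         ≡⟨ cong (_- y) (*-inv (ι (suc i)) (ι-suc≢0 i)) ⟩
    1ℚ - y                    ∎
    where y = inv (ι (suc i))

recipSum₁-value : ∀ s → recipSum 1 s ≡ (+ (2 ℕ.^ suc s ∸ 1)) / suc s
recipSum₁-value s = begin
  recipSum 1 s
    ≡⟨ divide (recipSum 1 s) (ι (suc s)) _ (ι-suc≢0 s) (trans (QP.*-comm (recipSum 1 s) (ι (suc s))) (recipSum₁-closed s)) ⟩
  (pow2 (suc s) - 1ℚ) * inv (ι (suc s))
    ≡⟨ cong (λ t → (t - 1ℚ) * inv (ι (suc s))) (pow2-ι (suc s)) ⟩
  (ι (2 ℕ.^ suc s) - 1ℚ) * inv (ι (suc s))
    ≡⟨ cong (_* inv (ι (suc s))) (sym (ι-∸1 (2 ℕ.^ suc s) (ℕP.m^n>0 2 (suc s)))) ⟩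
  ι (2 ℕ.^ suc s ∸ 1) * inv (ι (suc s))
    ≡⟨ sym (/-as-inv (2 ℕ.^ suc s ∸ 1) s) ⟩
  (+ (2 ℕ.^ suc s ∸ 1)) / suc s ∎
  where open ≡-Reasoning

sumTerms-binom : ∀ m → sumTerms m ≡ recipSum 0 m
sumTerms-binom zero = refl
sumTerms-binom (suc s) = cong₂ _+_ (sumTerms-binom s) (sym (recipSum₁-value s))

recipSum₂-value : ∀ m → recipSum 2 m ≡ (+ (m ℕ.* 2 ℕ.^ suc m ℕ.+ 1)) / (suc (suc m) ℕ.* suc m)
recipSum₂-value m = begin
  recipSum 2 m
    ≡⟨ divide (recipSum 2 m) (ι (suc (suc m) ℕ.* suc m)) _ (ι-suc≢0 (m ℕ.+ suc m ℕ.* suc m)) cleared ⟩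
  ι (m ℕ.* 2 ℕ.^ suc m ℕ.+ 1) * inv (ι (suc (suc m) ℕ.* suc m))
    ≡⟨ sym (/-as-inv (m ℕ.* 2 ℕ.^ suc m ℕ.+ 1) (m ℕ.+ suc m ℕ.* suc m)) ⟩
  (+ (m ℕ.* 2 ℕ.^ suc m ℕ.+ 1)) / (suc (suc m) ℕ.* suc m) ∎
  where
  open ≡-Reasoning
  P : ℚ
  P = pow2 (suc m)
  j₁ : ℚ
  j₁ = ι (suc m)
  j₂ : ℚ
  j₂ = ι (suc (suc m))
  E : ℚ
  E = recipSum 2 m
  cleared : E * ι (suc (suc m) ℕ.* suc m) ≡ ι (m ℕ.* 2 ℕ.^ suc m ℕ.+ 1)
  cleared = begin
    E * ι (suc (suc m) ℕ.* suc m)   ≡⟨ cong (E *_) (ι-* (suc (suc m)) (suc m)) ⟩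
    E * (j₂ * j₁)                   ≡⟨ solve 3 (λ e a b → e :* (a :* b) := a :* (b :* e)) refl E j₂ j₁ ⟩
    j₂ * (j₁ * E)                   ≡⟨ cong (j₂ *_) (recipSum₂-step m) ⟩
    j₂ * (P - recipSum 1 (suc m))   ≡⟨ solve 3 (λ a p d → a :* (p :- d) := a :* p :- a :* d) refl j₂ P (recipSum 1 (suc m)) ⟩
    j₂ * P - j₂ * recipSum 1 (suc m) ≡⟨ cong (λ t → j₂ * P - t) (recipSum₁-closed (suc m)) ⟩
    j₂ * P - (P + P - 1ℚ)           ≡⟨ cong (λ t → t * P - (P + P - 1ℚ)) (trans (ι-suc (suc m)) (cong (λ t → 1ℚ + t) (ι-suc m))) ⟩
    (1ℚ + (1ℚ + ι m)) * P - (P + P - 1ℚ)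
      ≡⟨ solve 2 (λ a p → (con 1ℚ :+ (con 1ℚ :+ a)) :* p :- (p :+ p :- con 1ℚ) := a :* p :+ con 1ℚ) refl (ι m) P ⟩
    ι m * P + 1ℚ                    ≡⟨ cong (λ t → ι m * t + 1ℚ) (pow2-ι (suc m)) ⟩
    ι m * ι (2 ℕ.^ suc m) + ι 1     ≡⟨ cong (_+ ι 1) (sym (ι-* m (2 ℕ.^ suc m))) ⟩
    ι (m ℕ.* 2 ℕ.^ suc m) + ι 1     ≡⟨ sym (ι-+ (m ℕ.* 2 ℕ.^ suc m) 1) ⟩
    ι (m ℕ.* 2 ℕ.^ suc m ℕ.+ 1)     ∎

spectralSumQ : ∀ m → spectralSum (suc (suc m)) (suc m) ≡ inv (ι 2) * (recipSum 0 m + ι 3 * recipSum 2 m)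
spectralSumQ m = begin
  spectralSum (suc (suc m)) (suc m)
    ≡⟨ trans (Σv-cong (suc (suc m)) (λ S → cong inv (ΛQ-ν m S))) (Σv-ν m (λ j → inv (ι j))) ⟩
  binomSum m (λ i → inv (ι (2 ℕ.* i)) + ι 3 * inv (ι (2 ℕ.* i ℕ.+ 4)))
    ≡⟨ binomSum-cong m halve ⟩
  binomSum m (λ i → h * inv (ι i) + ι 3 * (h * inv (ι (2 ℕ.+ i))))
    ≡⟨ trans (binomSum-+ m _ _) (cong₂ _+_ (binomSum-* m h _) (trans (binomSum-* m (ι 3) _) (cong (ι 3 *_) (binomSum-* m h _)))) ⟩
  h * recipSum 0 m + ι 3 * (h * recipSum 2 m)
    ≡⟨ solve 4 (λ h a t e → h :* a :+ t :* (h :* e) := h :* (a :+ t :* e)) refl h (recipSum 0 m) (ι 3) (recipSum 2 m) ⟩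
  h * (recipSum 0 m + ι 3 * recipSum 2 m) ∎
  where
  open ≡-Reasoning
  h : ℚ
  h = inv (ι 2)
  doubled : ∀ i → 2 ℕ.* i ℕ.+ 4 ≡ 2 ℕ.* (2 ℕ.+ i)
  doubled i = trans (sym (ℕP.*-distribˡ-+ 2 i 2)) (cong (2 ℕ.*_) (ℕP.+-comm i 2))
  halve : ∀ i → inv (ι (2 ℕ.* i)) + ι 3 * inv (ι (2 ℕ.* i ℕ.+ 4)) ≡ h * inv (ι i) + ι 3 * (h * inv (ι (2 ℕ.+ i)))
  halve i = cong₂ (λ s t → s + ι 3 * t)
    (trans (cong inv (ι-* 2 i)) (inv-ι2* (ι i)))
    (trans (cong (λ t → inv (ι t)) (doubled i)) (trans (cong inv (ι-* 2 (2 ℕ.+ i))) (inv-ι2* (ι (2 ℕ.+ i)))))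

kirchhoffQ-value : ∀ m → pow2 (suc (suc m)) * spectralSum (suc (suc m)) (suc m) ≡ formula (suc (suc m))
kirchhoffQ-value m = begin
  pow2 (suc (suc m)) * spectralSum (suc (suc m)) (suc m)
    ≡⟨ cong ((P + P) *_) (spectralSumQ m) ⟩
  (P + P) * (inv (ι 2) * X)
    ≡⟨ solve 3 (λ p h x → (p :+ p) :* (h :* x) := p :* ((con (ι 2) :* h) :* x)) refl P (inv (ι 2)) X ⟩
  P * ((ι 2 * inv (ι 2)) * X)
    ≡⟨ cong (λ t → P * (t * X)) (*-inv (ι 2) (ι-suc≢0 1)) ⟩
  P * (1ℚ * X)
    ≡⟨ cong (P *_) (QP.*-identityˡ X) ⟩
  P * X
    ≡⟨ cong₂ (λ s t → s * (t + ι 3 * recipSum 2 m)) (pow2-ι (suc m)) (sym (sumTerms-binom m)) ⟩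
  ι (2 ℕ.^ suc m) * (sumTerms m + ι 3 * recipSum 2 m)
    ≡⟨ cong (λ t → ι (2 ℕ.^ suc m) * (sumTerms m + ι 3 * t)) (recipSum₂-value m) ⟩
  formula (suc (suc m)) ∎
  where
  open ≡-Reasoning
  P : ℚ
  P = pow2 (suc m)
  X : ℚ
  X = recipSum 0 m + ι 3 * recipSum 2 m

corollary5 : ∀ (n : ℕ) → 2 ≤ n →
    Σ (Vertex n → Vertex n → Vertex n → ℚ) (IsPotentialFamily n (n ∸ 1))
      × (∀ φ → IsPotentialFamily n (n ∸ 1) φ → kirchhoffIndex n φ ≡ formula n)
corollary5 zero ()
corollary5 (suc zero) (s≤s ())
corollary5 (suc (suc m)) _ =
  (Green.ψ n k (gapQ m) , Green.ψ-potential n k (gapQ m)) ,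
  λ φ φ-pot → trans (kirchhoff-spectral n k (gapQ m) φ φ-pot) (kirchhoffQ-value m)
  where
  n : ℕ
  n = suc (suc m)
  k : ℕ
  k = suc m
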